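{- In Ruleset C', let $G=\langle \mathrm{Nim}(i_1),\dots,\mathrm{Nim}(i_\ell)\rangle_{C'}$ be a superposition of single Nim heaps and $k=\max_{1\le j\le\ell} i_j$. Then $G\equiv 0$ if $G=\langle\mathrm{Nim}(1),\mathrm{Nim}(2)\rangle$ or $G=\langle\mathrm{Nim}(0),\mathrm{Nim}(1),\mathrm{Nim}(2)\rangle$; otherwise $G\equiv *$ if $k=1$; otherwise $G\equiv *(k-1)$ if $k-1\in\{i_1,\dots,i_\ell\}$; and $G\equiv *k$ in all remaining cases.
   Context: $\mathrm{Nim}(x)$ is a single Nim heap of $x$ tokens; a classical move $(1,-j)$, $j\ge1$, removes $j$ tokens and is legal iff $x\ge j$. Quantum variation: a quantum position is a finite nonempty set $\langle G_1,\dots,G_n\rangle$ of classical positions (multiplicities irrelevant). A classical move is legal in it if legal in at least one $G_i$. A Q-move is a finite nonempty set of classical moves, each legal in the current quantum position; it leads to the set of all positions obtained by applying one of its moves to one of the $G_i$ where that move is legal. A Q-move with a single classical move is unsuperposed. Ruleset C' (subscript $C'$): Q-moves with at least two distinct classical moves are allowed; an unsuperposed move $m$ is allowed iff $m$ is legal in every $G_i$ of the superposition in which the player has at least one legal classical move. Normal convention: a player with no allowed Q-move loses. $*n$ denotes the value (equivalence class under $G\equiv H$ iff $G+X$, $H+X$ have the same outcome for all games $X$) of a classical Nim heap of $n$ tokens, with $*0=0$, $*1=*$. -}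

module Defs where

open import Data.Nat using (ℕ; zero; suc; _+_; _∸_; _⊔_; _≤ᵇ_; _≡ᵇ_)
open import Data.Fin using (Fin; zero; suc; splitAt)
open import Data.Sum using ([_,_]′)
open import Data.Product using (Σ)
open import Data.Bool using (Bool; true; false; _∨_; if_then_else_)
open import Data.List using (List; []; _∷_; _++_; map; length; lookup; foldr; concatMap; filterᵇ)
open import Function.Bundles using (_⇔_)

data Game : Set where
  game : (n : ℕ) → (Fin n → Game) → Game

infixl 6 _+ᴳ_
_+ᴳ_ : Game → Game → Game
game n f +ᴳ game m g =
  game (n + m) (λ i → [ (λ a → f a +ᴳ game m g) , (λ b → game n f +ᴳ g b) ]′ (splitAt n i))

Win  : Game → Set
Lose : Game → Set
Win  (game n f) = Σ (Fin n) (λ i → Lose (f i))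
Lose (game n f) = (i : Fin n) → Win (f i)

-- G ≡ H iff G + X and H + X have the same outcome for every game X.
-- (For impartial games the outcome is P or N, and N is the complement of P.)
infix 4 _≈ᴳ_
_≈ᴳ_ : Game → Game → Set
G ≈ᴳ H = (X : Game) → Lose (G +ᴳ X) ⇔ Lose (H +ᴳ X)

nim     : ℕ → Game
nimOpts : (n : ℕ) → Fin n → Game
nim n = game n (nimOpts n)
nimOpts (suc n) zero    = nim n
nimOpts (suc n) (suc i) = nimOpts n i

-- A quantum position ⟨Nim(i_1),...,Nim(i_l)⟩ is represented by the list
-- of heap sizes (read as a set: order and multiplicities are irrelevant).

allᵇ : (ℕ → Bool) → List ℕ → Bool
allᵇ p []       = true
allᵇ p (x ∷ xs) = if p x then allᵇ p xs else false

maxL : List ℕ → ℕ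
maxL = foldr _⊔_ 0

sublists : List ℕ → List (List ℕ)
sublists []       = [] ∷ []
sublists (x ∷ xs) = map (x ∷_) (sublists xs) ++ sublists xs

range1 : ℕ → List ℕ
range1 zero    = []
range1 (suc k) = suc k ∷ range1 k

-- A classical move j is legal in the superposition S iff j ≤ maxL S, so the
-- candidate Q-moves are the nonempty subsets of range1 (maxL S).
-- Ruleset C': Q-moves with at least two distinct moves are allowed; the
-- unsuperposed move {j} is allowed iff j is legal in every heap x of S in
-- which some move is legal (i.e. every x ≥ 1).
allowedC' : List ℕ → List ℕ → Bool
allowedC' S []          = false
allowedC' S (j ∷ [])    = allᵇ (λ x → (x ≡ᵇ 0) ∨ (j ≤ᵇ x)) S
allowedC' S (_ ∷ _ ∷ _) = true

qMoves : List ℕ → List (List ℕ)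
qMoves S = filterᵇ (allowedC' S) (sublists (range1 (maxL S)))

result : List ℕ → List ℕ → List ℕ
result S M = concatMap (λ j → concatMap (λ x → if j ≤ᵇ x then (x ∸ j) ∷ [] else []) S) M

-- game tree with a fuel parameter (every move strictly lowers maxL, so
-- fuel suc (maxL S) is always sufficient and the fuel-0 case is never reached)
qgame : ℕ → List ℕ → Game
qgame zero    S = game 0 (λ ())
qgame (suc f) S = game (length (qMoves S)) (λ i → qgame f (result S (lookup (qMoves S) i)))

QNimC' : List ℕ → Game
QNimC' S = qgame (suc (maxL S)) S

module Submission where

-- Proof strategy.  We compute the Grundy value of every superposition
-- S = ⟨Nim(i₁), …, Nim(iₗ)⟩ in Ruleset C' and compare it with Nim heaps.
--
-- Two games with the same Grundy value are equivalent (grundy⇒≈); in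
--    particular a game with Grundy value v is equivalent to *v.
-- 2. For a superposition S with largest heap k we define
--    value S = 0 if k = 0;  1 if k = 1;  0 if k = 2 and 1 ∈ S;
--    k - 1 if k ≥ 3 and k - 1 ∈ S;  k otherwise,
--    and show that it is the Grundy value of the game tree of S: no Q-move
--    preserves the value (changes-value), and every smaller value is reached,
--    mostly by a superposed move {k, j} which shifts the heaps down by j
--    (module PairMove, reach).
-- 3. Theorem 8 is then a case distinction on value S.

open import Defs
open import Data.Bool using (Bool; true; false; T; _∨_; if_then_else_)
open import Data.Bool.Properties using (T-∨)
open import Data.Empty using (⊥-elim)
open import Data.Fin using (Fin; zero; suc; splitAt; _↑ˡ_; _↑ʳ_)
open import Data.Fin.Properties using (splitAt-↑ˡ; splitAt-↑ʳ; all?; any?)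
open import Data.List using (List; []; _∷_; map; concatMap; length; lookup)
open import Data.List.Membership.Propositional using (_∈_; _∉_; find; lose)
open import Data.List.Membership.Propositional.Properties using (∈-++⁺ˡ; ∈-++⁺ʳ; ∈-++⁻; ∈-map⁺; ∈-map⁻; ∈-filter⁺; ∈-filter⁻; ∈-concatMap⁺; ∈-concatMap⁻; ∈-lookup)
open import Data.List.Relation.Unary.Any using (here; there; index)
open import Data.List.Relation.Unary.Any.Properties using (lookup-index)
open import Data.Nat using (ℕ; zero; suc; pred; _+_; _∸_; _<_; _≤_; _≤ᵇ_; _≡ᵇ_; s≤s; z≤n; _≟_)
open import Data.Nat.Properties using (<-cmp; <⇒≢; <⇒≱; ≤-refl; ≤-reflexive; ≤-trans; ≤-antisym; ≤-pred; ≤∧≢⇒<; n≤1+n; n<1+n; m≤n⇒m≤1+n; m≤n+m; n≤0⇒n≡0; 1+n≢0; 1+n≰n; +-suc; m≤m⊔n; m≤n⊔m; ⊔-lub; ⊔-sel; ∸-mono; m+n∸n≡m; m∸n+n≡m; m≤n⇒m∸n≡0; m≤n⇒∃[o]m+o≡n; ≤⇒≤ᵇ; ≤ᵇ⇒≤; ≡ᵇ⇒≡)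
open import Data.List.Membership.DecPropositional _≟_ using (_∈?_)
open import Data.Product using (Σ; _×_; _,_; proj₁; proj₂)
open import Data.Sum using (_⊎_; inj₁; inj₂; [_,_]; [_,_]′)
open import Data.Unit using (tt)
open import Function using (_∘_)
open import Function.Bundles using (_⇔_; mk⇔; Equivalence)
open import Relation.Binary using (tri<; tri≈; tri>)
open import Relation.Binary.PropositionalEquality using (_≡_; _≢_; refl; sym; trans; cong; subst; module ≡-Reasoning)
open import Relation.Nullary using (¬_; Dec; yes; no; does)
open import Relation.Nullary.Decidable using (T?; dec-true; dec-false)

open Equivalence using (to; from)

HasGrundy : Game → ℕ → Set
HasGrundy (game n f) v =
    ((i : Fin n) → Σ ℕ λ w → HasGrundy (f i) w × w ≢ v)
  × ((w : ℕ) → w < v → Σ (Fin n) λ i → HasGrundy (f i) w)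

lose-not-win : ∀ G → Lose G → ¬ Win G
lose-not-win (game n f) l (i , l′) = lose-not-win (f i) l′ (l i)

lose? : ∀ G → Dec (Lose G)
win?  : ∀ G → Dec (Win G)
lose? (game n f) = all? λ i → win? (f i)
win?  (game n f) = any? λ i → lose? (f i)

¬lose⇒win : ∀ G → ¬ Lose G → Win G
¬win⇒lose : ∀ G → ¬ Win G → Lose G
¬lose⇒win G nl with win? G
... | yes w = w
... | no nw = ⊥-elim (nl (¬win⇒lose G nw))
¬win⇒lose (game n f) nw i = ¬lose⇒win (f i) λ l → nw (i , l)

sumBranch : ∀ {n} → (Fin n → Game) → ∀ {m} → (Fin m → Game) → Fin n ⊎ Fin m → Game
sumBranch {n} f {m} g = [ (λ a → f a +ᴳ game m g) , (λ b → game n f +ᴳ g b) ]′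

sumBranch-left : ∀ {n} (f : Fin n → Game) {m} (g : Fin m → Game) a →
                 sumBranch f g (splitAt n (a ↑ˡ m)) ≡ f a +ᴳ game m g
sumBranch-left {n} f {m} g a = cong (sumBranch f g) (splitAt-↑ˡ n a m)

sumBranch-right : ∀ {n} (f : Fin n → Game) {m} (g : Fin m → Game) b →
                  sumBranch f g (splitAt n (n ↑ʳ b)) ≡ game n f +ᴳ g b
sumBranch-right {n} f {m} g b = cong (sumBranch f g) (splitAt-↑ʳ n m b)

win-left : ∀ {n f m g} a → Lose (f a +ᴳ game m g) → Win (game n f +ᴳ game m g)
win-left {f = f} {g = g} a l = _ , subst Lose (sym (sumBranch-left f g a)) l

lose-left : ∀ {n f m g} → Lose (game n f +ᴳ game m g) → ∀ a → Win (f a +ᴳ game m g)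
lose-left {f = f} {g = g} l a = subst Win (sumBranch-left f g a) (l _)

lose-right : ∀ {n f m g} → Lose (game n f +ᴳ game m g) → ∀ b → Win (game n f +ᴳ g b)
lose-right {f = f} {g = g} l b = subst Win (sumBranch-right f g b) (l _)

lose-intro : ∀ {n f m g} → (∀ a → Win (f a +ᴳ game m g)) → (∀ b → Win (game n f +ᴳ g b)) →
             Lose (game n f +ᴳ game m g)
lose-intro {n} wl wr i with splitAt n i
... | inj₁ a = wl a
... | inj₂ b = wr b

-- Moves of H to an option K of value w ≠ v are answered by optionGrundy-win:
-- if w > v, K has an option of value v (higherGrundy-win); if w < v, a losing
-- K + X would make G's option of value w lose against X too (lowerGrundy-win).
sameGrundy-lose  : ∀ G H {v} → HasGrundy G v → HasGrundy H v →
                   ∀ X → Lose (G +ᴳ X) → Lose (H +ᴳ X)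
optionGrundy-win : ∀ G K {v w} → HasGrundy G v → HasGrundy K w → w ≢ v →
                   ∀ X → Lose (G +ᴳ X) → Win (K +ᴳ X)
higherGrundy-win : ∀ G K {v w} → HasGrundy G v → HasGrundy K w → v < w →
                   ∀ X → Lose (G +ᴳ X) → Win (K +ᴳ X)
lowerGrundy-win  : ∀ G K {v w} → HasGrundy G v → HasGrundy K w → w < v →
                   ∀ X → Lose (G +ᴳ X) → Win (K +ᴳ X)

sameGrundy-lose (game a f) (game b h) gG gH@(hAvoid , _) (game c x) l = lose-intro
  (λ i → let (w , hw , w≢v) = hAvoid i in optionGrundy-win (game a f) (h i) gG hw w≢v (game c x) l)
  (λ k → ¬lose⇒win _ λ HxX →
           lose-not-win _ (sameGrundy-lose (game b h) (game a f) gH gG (x k) HxX) (lose-right l k))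

optionGrundy-win G K {v} {w} gG gK w≢v X l with <-cmp w v
... | tri< w<v _ _ = lowerGrundy-win G K gG gK w<v X l
... | tri≈ _ w≡v _ = ⊥-elim (w≢v w≡v)
... | tri> _ _ v<w = higherGrundy-win G K gG gK v<w X l

higherGrundy-win G (game b k) {v} gG (_ , kReach) v<w (game c x) l with kReach v v<w
... | i , kv = win-left i (sameGrundy-lose G (k i) gG kv (game c x) l)

lowerGrundy-win (game a f) K {w = w} (_ , gReach) gK w<v (game c x) l with gReach w w<v
... | j , fw = ¬lose⇒win _ λ KX →
                 lose-not-win _ (sameGrundy-lose K (f j) gK fw (game c x) KX) (lose-left l j)

grundy⇒≈ : ∀ {G H v} → HasGrundy G v → HasGrundy H v → G ≈ᴳ H
grundy⇒≈ {G} {H} gG gH X = mk⇔ (sameGrundy-lose G H gG gH X) (sameGrundy-lose H G gH gG X)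

nim-grundy    : ∀ n → HasGrundy (nim n) n
nimOpt-below  : ∀ n i → Σ ℕ λ w → HasGrundy (nimOpts n i) w × w < n
nimOpt-onto   : ∀ n w → w < n → Σ (Fin n) λ i → HasGrundy (nimOpts n i) w

nim-grundy n = avoid , nimOpt-onto n
  where
  avoid : ∀ i → Σ ℕ λ w → HasGrundy (nimOpts n i) w × w ≢ n
  avoid i with nimOpt-below n i
  ... | w , gw , w<n = w , gw , <⇒≢ w<n

nimOpt-below (suc n) zero = n , nim-grundy n , ≤-refl
nimOpt-below (suc n) (suc i) with nimOpt-below n i
... | w , gw , w<n = w , gw , m≤n⇒m≤1+n w<n

nimOpt-onto (suc n) w (s≤s w≤n) with <-cmp w n
... | tri≈ _ refl _ = zero , nim-grundy n
... | tri< w<n _ _ with nimOpt-onto n w w<n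
...   | i , gw = suc i , gw
nimOpt-onto (suc n) w (s≤s w≤n) | tri> _ _ n<w = ⊥-elim (<⇒≱ n<w w≤n)

maxL-ub : ∀ S {y} → y ∈ S → y ≤ maxL S
maxL-ub (x ∷ S) (here refl) = m≤m⊔n x (maxL S)
maxL-ub (x ∷ S) (there p)   = ≤-trans (maxL-ub S p) (m≤n⊔m x (maxL S))

maxL-lub : ∀ S {B} → (∀ {y} → y ∈ S → y ≤ B) → maxL S ≤ B
maxL-lub []      ub = z≤n
maxL-lub (x ∷ S) ub = ⊔-lub (ub (here refl)) (maxL-lub S (λ p → ub (there p)))

maxL-∈ : ∀ S {n} → maxL S ≡ suc n → suc n ∈ S
maxL-∈ (x ∷ S) eq with ⊔-sel x (maxL S)
... | inj₁ x⊔≡x = here (trans (sym eq) x⊔≡x)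
... | inj₂ x⊔≡m = there (maxL-∈ S (trans (sym x⊔≡m) eq))

maxL-unique : ∀ S {n} → n ∈ S → (∀ {y} → y ∈ S → y ≤ n) → maxL S ≡ n
maxL-unique S n∈S ub = ≤-antisym (maxL-lub S ub) (maxL-ub S n∈S)

record Origin (S M : List ℕ) (y : ℕ) : Set where
  constructor origin
  field
    move heap : ℕ
    move∈M    : move ∈ M
    heap∈S    : heap ∈ S
    move≤heap : move ≤ heap
    y≡        : y ≡ heap ∸ move

applyMove : ℕ → ℕ → List ℕ
applyMove j x = if j ≤ᵇ x then (x ∸ j) ∷ [] else []

applyMove⁺ : ∀ {j x} → j ≤ x → x ∸ j ∈ applyMove j x
applyMove⁺ {j} {x} j≤x with j ≤ᵇ x | ≤⇒≤ᵇ j≤x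
... | true | _ = here refl

applyMove⁻ : ∀ j x {y} → y ∈ applyMove j x → j ≤ x × y ≡ x ∸ j
applyMove⁻ j x p with j ≤ᵇ x in eq
applyMove⁻ j x (here y≡) | true = ≤ᵇ⇒≤ j x (subst T (sym eq) tt) , y≡

result⁺ : ∀ S M {j x} → j ∈ M → x ∈ S → j ≤ x → x ∸ j ∈ result S M
result⁺ S M {j} j∈M x∈S j≤x =
  ∈-concatMap⁺ (λ j → concatMap (applyMove j) S)
    (lose j∈M (∈-concatMap⁺ (applyMove j) (lose x∈S (applyMove⁺ j≤x))))

result⁻ : ∀ S M {y} → y ∈ result S M → Origin S M y
result⁻ S M p with find (∈-concatMap⁻ (λ j → concatMap (applyMove j) S) p)
... | j , j∈M , q with find (∈-concatMap⁻ (applyMove j) q)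
...   | x , x∈S , r with applyMove⁻ j x r
...     | j≤x , y≡ = origin j x j∈M x∈S j≤x y≡

result-max : ∀ S M {lo} → (∀ {j} → j ∈ M → lo ≤ j) → maxL (result S M) ≤ maxL S ∸ lo
result-max S M lo≤ = maxL-lub (result S M) λ p →
  let origin j x j∈M x∈S _ y≡ = result⁻ S M p
  in subst (_≤ _) (sym y≡) (∸-mono (maxL-ub S x∈S) (lo≤ j∈M))

range1-bounds : ∀ k {j} → j ∈ range1 k → 1 ≤ j × j ≤ k
range1-bounds (suc k) (here refl) = s≤s z≤n , ≤-refl
range1-bounds (suc k) (there p)   = let (1≤j , j≤k) = range1-bounds k p in 1≤j , m≤n⇒m≤1+n j≤k

sublists-⊆ : ∀ ys {xs j} → xs ∈ sublists ys → j ∈ xs → j ∈ ys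
sublists-⊆ [] (here refl) ()
sublists-⊆ (y ∷ ys) p j∈xs with ∈-++⁻ (map (y ∷_) (sublists ys)) p
... | inj₂ q = there (sublists-⊆ ys q j∈xs)
... | inj₁ q with ∈-map⁻ (y ∷_) q | j∈xs
...   | zs , _   , refl | here j≡y = here j≡y
...   | zs , zs∈ , refl | there j∈zs = there (sublists-⊆ ys zs∈ j∈zs)

[]∈sublists : ∀ ys → [] ∈ sublists ys
[]∈sublists []       = here refl
[]∈sublists (y ∷ ys) = ∈-++⁺ʳ (map (y ∷_) (sublists ys)) ([]∈sublists ys)

sublists-keep : ∀ y ys {xs} → xs ∈ sublists ys → (y ∷ xs) ∈ sublists (y ∷ ys)
sublists-keep y ys p = ∈-++⁺ˡ (∈-map⁺ (y ∷_) p)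

sublists-range1-mono : ∀ {n xs} k → xs ∈ sublists (range1 n) → n ≤ k → xs ∈ sublists (range1 k)
sublists-range1-mono zero p z≤n = p
sublists-range1-mono {n} (suc k) p n≤k with n ≟ suc k
... | yes refl = p
... | no  n≢k  = ∈-++⁺ʳ (map (suc k ∷_) (sublists (range1 k)))
                   (sublists-range1-mono k p (≤-pred (≤∧≢⇒< n≤k n≢k)))

singleton∈sublists : ∀ {j k} → 1 ≤ j → j ≤ k → (j ∷ []) ∈ sublists (range1 k)
singleton∈sublists {suc j} {k} _ j≤k =
  sublists-range1-mono k (sublists-keep (suc j) (range1 j) ([]∈sublists (range1 j))) j≤k

pair∈sublists : ∀ {p q k} → 1 ≤ q → q < p → p ≤ k → (p ∷ q ∷ []) ∈ sublists (range1 k)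
pair∈sublists {suc p} {q} {k} 1≤q q<p p≤k =
  sublists-range1-mono k (sublists-keep (suc p) (range1 p) (singleton∈sublists 1≤q (≤-pred q<p))) p≤k

allᵇ⁺ : ∀ p S → (∀ {x} → x ∈ S → T (p x)) → T (allᵇ p S)
allᵇ⁺ p []      h = tt
allᵇ⁺ p (x ∷ S) h with p x | h (here refl)
... | true | _ = allᵇ⁺ p S (λ q → h (there q))

allᵇ⁻ : ∀ p S {x} → T (allᵇ p S) → x ∈ S → T (p x)
allᵇ⁻ p (x ∷ S) t q with p x in eq
allᵇ⁻ p (x ∷ S) t (here refl) | true = subst T (sym eq) tt
allᵇ⁻ p (x ∷ S) t (there q)   | true = allᵇ⁻ p S t q

qMove⁻ : ∀ S {M} → M ∈ qMoves S → M ∈ sublists (range1 (maxL S)) × T (allowedC' S M)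
qMove⁻ S = ∈-filter⁻ (T? ∘ allowedC' S)

qMove⁺ : ∀ S {M} → M ∈ sublists (range1 (maxL S)) → T (allowedC' S M) → M ∈ qMoves S
qMove⁺ S = ∈-filter⁺ (T? ∘ allowedC' S)

pair-qMove : ∀ S {p q} → 1 ≤ q → q < p → p ≤ maxL S → (p ∷ q ∷ []) ∈ qMoves S
pair-qMove S 1≤q q<p p≤k = qMove⁺ S (pair∈sublists 1≤q q<p p≤k) tt

singleton-qMove : ∀ S {j} → 1 ≤ j → j ≤ maxL S → (∀ {x} → x ∈ S → x ≡ 0 ⊎ j ≤ x) → (j ∷ []) ∈ qMoves S
singleton-qMove S 1≤j j≤k ok = qMove⁺ S (singleton∈sublists 1≤j j≤k) (allᵇ⁺ _ S (λ x∈S → fits (ok x∈S)))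
  where
  fits : ∀ {j x} → x ≡ 0 ⊎ j ≤ x → T ((x ≡ᵇ 0) ∨ (j ≤ᵇ x))
  fits (inj₁ refl) = tt
  fits (inj₂ j≤x)  = from T-∨ (inj₂ (≤⇒≤ᵇ j≤x))

singleton-allowed⁻ : ∀ S {j x} → T (allowedC' S (j ∷ [])) → x ∈ S → x ≡ 0 ⊎ j ≤ x
singleton-allowed⁻ S {j} {x} t x∈S with to T-∨ (allᵇ⁻ _ S t x∈S)
... | inj₁ x≡ᵇ0 = inj₁ (≡ᵇ⇒≡ x 0 x≡ᵇ0)
... | inj₂ j≤ᵇx = inj₂ (≤ᵇ⇒≤ j x j≤ᵇx)

qMove-bounds : ∀ S {M j} → M ∈ qMoves S → j ∈ M → 1 ≤ j × j ≤ maxL S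
qMove-bounds S M∈ j∈M = range1-bounds (maxL S) (sublists-⊆ (range1 (maxL S)) (proj₁ (qMove⁻ S M∈)) j∈M)

qMove-lowers : ∀ S {M} → M ∈ qMoves S → Σ ℕ λ k → maxL S ≡ suc k × maxL (result S M) ≤ k
qMove-lowers S {j ∷ M} M∈ with maxL S in eq | qMove-bounds S M∈ (here refl)
... | zero  | s≤s _ , ()
... | suc k | _ = k , refl , subst (λ m → maxL (result S (j ∷ M)) ≤ m ∸ 1) eq
                               (result-max S (j ∷ M) (λ i∈M → proj₁ (qMove-bounds S M∈ i∈M)))
qMove-lowers S {[]} M∈ with () ← proj₂ (qMove⁻ S M∈)

-- The Grundy value of a superposition whose largest heap is k; the flag b
-- records whether the heap k ∸ 1 occurs as well.
topValue : ℕ → Bool → ℕ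
topValue zero                _     = 0
topValue (suc zero)          _     = 1
topValue (suc (suc k))       false = suc (suc k)
topValue (suc (suc zero))    true  = 0
topValue (suc (suc (suc k))) true  = suc (suc k)

hasBelowTop : List ℕ → Bool
hasBelowTop S = does (pred (maxL S) ∈? S)

value : List ℕ → ℕ
value S = topValue (maxL S) (hasBelowTop S)

topValue-false : ∀ k → topValue k false ≡ k
topValue-false zero          = refl
topValue-false (suc zero)    = refl
topValue-false (suc (suc k)) = refl

topValue-≤ : ∀ k b → topValue k b ≤ k
topValue-≤ zero                _     = z≤n
topValue-≤ (suc zero)          _     = ≤-refl
topValue-≤ (suc (suc k))       false = ≤-refl
topValue-≤ (suc (suc zero))    true  = z≤n
topValue-≤ (suc (suc (suc k))) true  = n≤1+n _

topValue-true-< : ∀ k → topValue (suc (suc k)) true < suc (suc k)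
topValue-true-< zero    = s≤s z≤n
topValue-true-< (suc k) = n<1+n (suc (suc k))

value-≤ : ∀ S → value S ≤ maxL S
value-≤ S = topValue-≤ (maxL S) (hasBelowTop S)

value-at : ∀ S {k} → maxL S ≡ k → value S ≡ topValue k (hasBelowTop S)
value-at S eq = cong (λ k → topValue k (hasBelowTop S)) eq

value-with : ∀ S {k} → maxL S ≡ k → pred k ∈ S → value S ≡ topValue k true
value-with S eq p =
  trans (value-at S eq) (cong (topValue _) (dec-true (_ ∈? S) (subst (λ k → pred k ∈ S) (sym eq) p)))

value-without : ∀ S {k} → maxL S ≡ k → pred k ∉ S → value S ≡ k
value-without S {k} eq p = begin
  value S                          ≡⟨ value-at S eq ⟩
  topValue k (hasBelowTop S)       ≡⟨ cong (topValue k) (dec-false (_ ∈? S) (p ∘ subst (λ k → pred k ∈ S) eq)) ⟩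
  topValue k false                 ≡⟨ topValue-false k ⟩
  k                                ∎
  where open ≡-Reasoning

value-emptied : ∀ S → maxL S ≤ 0 → value S ≡ 0
value-emptied S S≤0 = value-at S (n≤0⇒n≡0 S≤0)

belowTop-true⇒ : ∀ S → hasBelowTop S ≡ true → pred (maxL S) ∈ S
belowTop-true⇒ S eq with pred (maxL S) ∈? S
belowTop-true⇒ S refl | yes p = p

belowTop-false⇒ : ∀ S → hasBelowTop S ≡ false → pred (maxL S) ∉ S
belowTop-false⇒ S eq with pred (maxL S) ∈? S
belowTop-false⇒ S refl | no ¬p = ¬p

topValue-flag : ∀ r {b b′} → (1 ≤ r → b ≡ b′) → topValue (suc r) b ≡ topValue (suc r) b′
topValue-flag zero    _  = refl
topValue-flag (suc r) eq = cong (topValue (suc (suc r))) (eq (s≤s z≤n))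

does-⇔ : ∀ {A B : Set} (a? : Dec A) (b? : Dec B) → (A → B) → (B → A) → does a? ≡ does b?
does-⇔ (yes a) b? f g = sym (dec-true b? (f a))
does-⇔ (no ¬a) b? f g = sym (dec-false b? (¬a ∘ g))

-- The superposed move {r + 1 + j, j} (j ≥ 1) from a superposition whose largest
-- heap is r + 1 + j: the top heap is emptied and every other heap y + j is
-- shifted down to y, so the new largest heap is r + 1 and the flag "the heap
-- below the top occurs" is unchanged.
module PairMove (S : List ℕ) (r j : ℕ) (1≤j : 1 ≤ j) (top : maxL S ≡ suc r + j) where

  M : List ℕ
  M = suc r + j ∷ j ∷ []

  R : List ℕ
  R = result S M

  M-qMove : M ∈ qMoves S
  M-qMove = pair-qMove S 1≤j (s≤s (m≤n+m j r)) (≤-reflexive (sym top))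

  unshift : ∀ {y} → y + j ∈ S → y ∈ R
  unshift {y} p = subst (_∈ R) (m+n∸n≡m y j) (result⁺ S M (there (here refl)) p (m≤n+m j y))

  shift : ∀ {y} → 1 ≤ y → y ∈ R → y + j ∈ S
  shift 1≤y p with result⁻ S M p
  ... | origin _ x (here refl) x∈S _ y≡ =
          ⊥-elim (<⇒≢ 1≤y (sym (trans y≡ (m≤n⇒m∸n≡0 (subst (x ≤_) top (maxL-ub S x∈S))))))
  ... | origin _ x (there (here refl)) x∈S j≤x y≡ =
          subst (_∈ S) (trans (sym (m∸n+n≡m j≤x)) (cong (_+ j) (sym y≡))) x∈S

  R-max : maxL R ≡ suc r
  R-max = maxL-unique R (unshift (maxL-∈ S top)) λ p →
    ≤-trans (maxL-ub R p) (subst (maxL R ≤_) (trans (cong (_∸ j) top) (m+n∸n≡m (suc r) j))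
                                   (result-max S M moves≥j))
    where
    moves≥j : ∀ {i} → i ∈ M → j ≤ i
    moves≥j (here refl)         = m≤n+m j (suc r)
    moves≥j (there (here refl)) = ≤-refl

  sameFlag : 1 ≤ r → hasBelowTop R ≡ hasBelowTop S
  sameFlag 1≤r = does-⇔ (pred (maxL R) ∈? R) (pred (maxL S) ∈? S)
    (λ p → subst (λ k → pred k ∈ S) (sym top) (shift 1≤r (subst (λ k → pred k ∈ R) R-max p)))
    (λ p → subst (λ k → pred k ∈ R) (sym R-max) (unshift (subst (λ k → pred k ∈ S) top p)))

  R-value : value R ≡ topValue (suc r) (hasBelowTop S)
  R-value = trans (value-at R R-max) (topValue-flag r sameFlag)

Reach : List ℕ → ℕ → Set
Reach S t = Σ (List ℕ) λ M → M ∈ qMoves S × value (result S M) ≡ t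

-- Value 0 is reachable whenever S has nonzero value: with largest heap 1
-- play {1}; with largest heap 2 and no heap 1 play {2}; with largest heap
-- k + 3 play {k + 2, k + 1}, which leaves heaps 1 and 2 on top (value 0).
reach-zero : ∀ S {k} → maxL S ≡ k → 0 < topValue k (hasBelowTop S) → Reach S 0
reach-zero S {suc zero} top _ =
  1 ∷ [] , singleton-qMove S ≤-refl (≤-reflexive (sym top)) (λ {x} _ → positive x) ,
  value-emptied (result S (1 ∷ []))
    (subst (λ k → maxL (result S (1 ∷ [])) ≤ k ∸ 1) top (result-max S _ onlyMove))
  where
  positive : ∀ x → x ≡ 0 ⊎ 1 ≤ x
  positive zero    = inj₁ refl
  positive (suc x) = inj₂ (s≤s z≤n)
  onlyMove : ∀ {i} → i ∈ 1 ∷ [] → 1 ≤ i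
  onlyMove (here refl) = ≤-refl
reach-zero S {suc (suc zero)} top v>0 with hasBelowTop S in flag
reach-zero S {suc (suc zero)} top () | true
... | false =
  2 ∷ [] , singleton-qMove S (s≤s z≤n) (≤-reflexive (sym top)) (λ x∈S → emptyOrTwo (maxL-ub S x∈S) x∈S) ,
  value-emptied (result S (2 ∷ []))
    (subst (λ k → maxL (result S (2 ∷ [])) ≤ k ∸ 2) top (result-max S _ onlyMove))
  where
  one∉S : 1 ∉ S
  one∉S = subst (λ k → pred k ∉ S) top (belowTop-false⇒ S flag)
  emptyOrTwo : ∀ {x} → x ≤ maxL S → x ∈ S → x ≡ 0 ⊎ 2 ≤ x
  emptyOrTwo {zero}              _   _   = inj₁ refl
  emptyOrTwo {suc zero}          _   x∈S = ⊥-elim (one∉S x∈S)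
  emptyOrTwo {suc (suc x)}       _   _   = inj₂ (s≤s (s≤s z≤n))
  onlyMove : ∀ {i} → i ∈ 2 ∷ [] → 2 ≤ i
  onlyMove (here refl) = ≤-refl
reach-zero S {suc (suc (suc k))} top _ =
  M , pair-qMove S (s≤s z≤n) ≤-refl (subst (_ ≤_) (sym top) (n≤1+n _)) ,
  value-with R (maxL-unique R two∈R R≤2) one∈R
  where
  M : List ℕ
  M = suc (suc k) ∷ suc k ∷ []
  R : List ℕ
  R = result S M
  k+3∈S : suc (suc (suc k)) ∈ S
  k+3∈S = maxL-∈ S top
  two∈R : 2 ∈ R
  two∈R = subst (_∈ R) (m+n∸n≡m 2 k) (result⁺ S M (there (here refl)) k+3∈S (m≤n⇒m≤1+n (n≤1+n _)))
  one∈R : 1 ∈ R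
  one∈R = subst (_∈ R) (m+n∸n≡m 1 (suc k)) (result⁺ S M (here refl) k+3∈S (n≤1+n _))
  movesLarge : ∀ {i} → i ∈ M → suc k ≤ i
  movesLarge (here refl)         = n≤1+n _
  movesLarge (there (here refl)) = ≤-refl
  R≤2 : ∀ {y} → y ∈ R → y ≤ 2
  R≤2 p = ≤-trans (maxL-ub R p)
            (≤-trans (subst (λ m → maxL R ≤ m ∸ suc k) top (result-max S M movesLarge)) (≤-reflexive (m+n∸n≡m 2 (suc k))))

-- Every value below topValue (k + 2) b, except 0 when b is false, is
-- topValue (r + 1) b for some r ≤ k: the value left by a move {k + 2, k + 1 ∸ r}.
topValue-onto : ∀ k b {t} → t < topValue (suc (suc k)) b → 0 < t ⊎ b ≡ true →
                Σ ℕ λ r → r ≤ k × topValue (suc r) b ≡ t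
topValue-onto k false {suc t} (s≤s t<k+1) _ = t , ≤-pred t<k+1 , topValue-false (suc t)
topValue-onto k false {zero} _ (inj₁ ())
topValue-onto (suc k) true {zero}        _                   _ = 1 , s≤s z≤n , refl
topValue-onto (suc k) true {suc zero}    _                   _ = 0 , z≤n , refl
topValue-onto (suc k) true {suc (suc t)} (s≤s (s≤s t+1≤k))   _ = suc (suc t) , s≤s t+1≤k , refl

reach-pair : ∀ S {k t} → maxL S ≡ suc (suc k) → t < topValue (suc (suc k)) (hasBelowTop S) →
             0 < t ⊎ hasBelowTop S ≡ true → Reach S t
reach-pair S {k} top t<v nonzero with topValue-onto k (hasBelowTop S) t<v nonzero
... | r , r≤k , r↦t with m≤n⇒∃[o]m+o≡n r≤k
...   | d , r+d≡k = M , M-qMove , trans R-value r↦t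
  where
  top′ : maxL S ≡ suc r + suc d
  top′ = trans top (cong suc (trans (cong suc (sym r+d≡k)) (sym (+-suc r d))))
  open PairMove S r (suc d) (s≤s z≤n) top′

reach : ∀ S {k t} → maxL S ≡ k → t < topValue k (hasBelowTop S) → Reach S t
reach S {zero}        top ()
reach S {suc zero}    {zero}  top t<v       = reach-zero S top t<v
reach S {suc zero}    {suc t} top (s≤s ())
reach S {suc (suc k)} {suc t} top t<v       = reach-pair S top t<v (inj₁ (s≤s z≤n))
reach S {suc (suc k)} {zero}  top t<v with hasBelowTop S in flag
... | false = reach-zero S top (subst (λ b → 0 < topValue (suc (suc k)) b) (sym flag) t<v)
... | true  = reach-pair S top (subst (λ b → 0 < topValue (suc (suc k)) b) (sym flag) t<v) (inj₂ flag)

-- With heaps exactly {1, 2} (plus possibly 0) every Q-move lands on value 1: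
-- the move {2} is forbidden by the heap 1, and any move containing 1 leaves
-- largest heap 1.
changes-twoWithOne : ∀ S {M} → M ∈ qMoves S → maxL S ≡ 2 → 1 ∈ S → maxL (result S M) ≤ 1 →
                     value (result S M) ≢ 0
changes-twoWithOne S {M} M∈ top 1∈S R≤1 =
  enumerate (subst (λ k → M ∈ sublists (range1 k)) top (proj₁ (qMove⁻ S M∈))) (proj₂ (qMove⁻ S M∈))
  where
  removesOne : 1 ∈ M → value (result S M) ≢ 0
  removesOne 1∈M v≡0 = 1+n≢0 (trans (sym (value-at (result S M) R-max)) v≡0)
    where
    R-max : maxL (result S M) ≡ 1
    R-max = ≤-antisym R≤1 (maxL-ub _ (result⁺ S M 1∈M (maxL-∈ S top) (s≤s z≤n)))
  enumerate : M ∈ sublists (2 ∷ 1 ∷ []) → T (allowedC' S M) → value (result S M) ≢ 0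
  enumerate (here refl)                         _  = removesOne (there (here refl))
  enumerate (there (here refl))                 ok with singleton-allowed⁻ S ok 1∈S
  ... | inj₂ (s≤s ())
  enumerate (there (there (here refl)))         _  = removesOne (here refl)
  enumerate (there (there (there (here refl)))) ()

-- If heap k + 2 occurs below the largest heap k + 3, no Q-move reaches value
-- k + 2: that would need largest heap k + 2 without heap k + 1, but the top
-- k + 2 can only come from the move 1, which also turns k + 2 into k + 1.
changes-withBelow : ∀ S {M k} → M ∈ qMoves S → maxL S ≡ suc (suc (suc k)) → suc (suc k) ∈ S →
                    maxL (result S M) ≤ suc (suc k) → value (result S M) ≢ suc (suc k)
changes-withBelow S {M} {k} M∈ top below∈S R≤ v≡ = noOrigin (result⁻ S M (maxL-∈ R R-max))
  where
  R : List ℕ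
  R = result S M
  R-max : maxL R ≡ suc (suc k)
  R-max = ≤-antisym R≤ (subst (_≤ maxL R) v≡ (value-≤ R))
  noOrigin : ¬ Origin S M (suc (suc k))
  noOrigin (origin zero _ j∈M _ _ _) with () ← proj₁ (qMove-bounds S M∈ j∈M)
  noOrigin (origin (suc zero) _ 1∈M _ _ _) =
    <⇒≢ (topValue-true-< k) (trans (sym (value-with R R-max (result⁺ S M 1∈M below∈S (s≤s z≤n)))) v≡)
  noOrigin (origin (suc (suc j)) x _ x∈S _ y≡) =
    1+n≰n (≤-trans (≤-reflexive y≡) (∸-mono (subst (x ≤_) top (maxL-ub S x∈S)) (s≤s (s≤s (z≤n {j})))))

value≢aboveMax : ∀ R {k v} → maxL R ≤ k → v ≡ suc k → value R ≢ v
value≢aboveMax R R≤k refl = <⇒≢ (s≤s (≤-trans (value-≤ R) R≤k))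

changes-value : ∀ S {M k} → M ∈ qMoves S → maxL S ≡ suc k → maxL (result S M) ≤ k →
                value (result S M) ≢ topValue (suc k) (hasBelowTop S)
changes-value S {M} {k} M∈ top R≤k with hasBelowTop S in flag
changes-value S {M} {k}           M∈ top R≤k | false = value≢aboveMax (result S M) R≤k (topValue-false (suc k))
changes-value S {M} {zero}        M∈ top R≤k | true  = value≢aboveMax (result S M) R≤k refl
changes-value S {M} {suc zero}    M∈ top R≤k | true  =
  changes-twoWithOne S M∈ top (subst (λ k → pred k ∈ S) top (belowTop-true⇒ S flag)) R≤k
changes-value S {M} {suc (suc k)} M∈ top R≤k | true  =
  changes-withBelow S M∈ top (subst (λ k → pred k ∈ S) top (belowTop-true⇒ S flag)) R≤k

qgame-grundy : ∀ f S → maxL S < f → HasGrundy (qgame f S) (value S)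
qgame-grundy (suc f) S S<f = avoid , reachIndex
  where
  option : Fin (length (qMoves S)) → List ℕ
  option i = lookup (qMoves S) i
  fuel : ∀ {M} → M ∈ qMoves S → maxL (result S M) < f
  fuel M∈ = let (k , top , R≤k) = qMove-lowers S M∈ in ≤-trans (s≤s R≤k) (subst (_≤ f) top (≤-pred S<f))
  avoid : ∀ i → Σ ℕ λ w → HasGrundy (qgame f (result S (option i))) w × w ≢ value S
  avoid i = let (k , top , R≤k) = qMove-lowers S (∈-lookup i) in
    value (result S (option i)) , qgame-grundy f _ (fuel (∈-lookup i)) ,
    λ v≡ → changes-value S (∈-lookup i) top R≤k (trans v≡ (value-at S top))
  reachIndex : ∀ w → w < value S → Σ (Fin (length (qMoves S))) λ i → HasGrundy (qgame f (result S (option i))) w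
  reachIndex w w<v = let (M , M∈ , v≡w) = reach S refl w<v in
    index M∈ , subst (λ M′ → HasGrundy (qgame f (result S M′)) w) (lookup-index M∈)
                 (subst (HasGrundy (qgame f (result S M))) v≡w (qgame-grundy f (result S M) (fuel M∈)))

QNimC'≈nim-value : ∀ L → QNimC' L ≈ᴳ nim (value L)
QNimC'≈nim-value L = grundy⇒≈ (qgame-grundy (suc (maxL L)) L ≤-refl) (nim-grundy (value L))

SameSet : List ℕ → List ℕ → Set
SameSet L K = (x : ℕ) → (x ∈ L ⇔ x ∈ K)

sameSet-maxL : ∀ {L K} → SameSet L K → maxL L ≡ maxL K
sameSet-maxL {L} {K} L≃K = ≤-antisym (maxL-lub L λ p → maxL-ub K (to (L≃K _) p))
                                     (maxL-lub K λ p → maxL-ub L (from (L≃K _) p))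

Exceptional : List ℕ → Set
Exceptional L = SameSet L (1 ∷ 2 ∷ []) ⊎ SameSet L (0 ∷ 1 ∷ 2 ∷ [])

exceptional⇒ : ∀ {L} → Exceptional L → maxL L ≡ 2 × 1 ∈ L
exceptional⇒ (inj₁ L≃12)  = sameSet-maxL L≃12  , from (L≃12 1) (here refl)
exceptional⇒ (inj₂ L≃012) = sameSet-maxL L≃012 , from (L≃012 1) (there (here refl))

⇒exceptional : ∀ {L} → maxL L ≡ 2 → 1 ∈ L → Exceptional L
⇒exceptional {L} top 1∈L = byZero (0 ∈? L)
  where
  upTo2 : ∀ {x} → x ≤ 2 → x ≡ 0 ⊎ x ∈ 1 ∷ 2 ∷ []
  upTo2 {zero}              _                = inj₁ refl
  upTo2 {suc zero}          _                = inj₂ (here refl)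
  upTo2 {suc (suc zero)}    _                = inj₂ (there (here refl))
  upTo2 {suc (suc (suc x))} (s≤s (s≤s ()))
  heaps : ∀ {x} → x ∈ L → x ≡ 0 ⊎ x ∈ 1 ∷ 2 ∷ []
  heaps {x} x∈L = upTo2 (subst (x ≤_) top (maxL-ub L x∈L))
  oneOrTwo : ∀ {x} → x ∈ 1 ∷ 2 ∷ [] → x ∈ L
  oneOrTwo (here refl)         = 1∈L
  oneOrTwo (there (here refl)) = maxL-∈ L top
  withZero : 0 ∈ L → ∀ {x} → x ∈ L → x ∈ 0 ∷ 1 ∷ 2 ∷ []
  withZero _ x∈L with heaps x∈L
  ... | inj₁ refl = here refl
  ... | inj₂ p    = there p
  withoutZero : 0 ∉ L → ∀ {x} → x ∈ L → x ∈ 1 ∷ 2 ∷ []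
  withoutZero 0∉L x∈L with heaps x∈L
  ... | inj₁ refl = ⊥-elim (0∉L x∈L)
  ... | inj₂ p    = p
  byZero : Dec (0 ∈ L) → Exceptional L
  byZero (yes 0∈L) = inj₂ λ x → mk⇔ (withZero 0∈L) λ { (here refl) → 0∈L ; (there p) → oneOrTwo p }
  byZero (no 0∉L)  = inj₁ λ x → mk⇔ (withoutZero 0∉L) oneOrTwo

value-withBelow : ∀ L m → ¬ Exceptional L → maxL L ≢ 1 → suc m ≡ maxL L → m ∈ L → value L ≡ m
value-withBelow L zero          _      k≢1 1≡k _   = ⊥-elim (k≢1 (sym 1≡k))
value-withBelow L (suc zero)    ¬exc   _   2≡k 1∈L = ⊥-elim (¬exc (⇒exceptional (sym 2≡k) 1∈L))
value-withBelow L (suc (suc m)) _      _   k≡  m∈L = value-with L (sym k≡) m∈L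

value-withoutBelow : ∀ L → ((m : ℕ) → suc m ≡ maxL L → m ∉ L) → value L ≡ maxL L
value-withoutBelow L noBelow = byTop refl
  where
  byTop : ∀ {k} → maxL L ≡ k → value L ≡ k
  byTop {zero}  top = value-at L top
  byTop {suc k} top = value-without L top (noBelow k (sym top))

-- Theorem 8: each case identifies value L.
mainTheorem8 : (L : List ℕ) → L ≢ [] →
    let k = maxL L
        A = (x : ℕ) → (x ∈ L ⇔ x ∈ (1 ∷ 2 ∷ []))
        B = (x : ℕ) → (x ∈ L ⇔ x ∈ (0 ∷ 1 ∷ 2 ∷ []))
    in ((A ⊎ B) → QNimC' L ≈ᴳ nim 0)
     × ((¬ A × ¬ B × k ≡ 1) → QNimC' L ≈ᴳ nim 1)
     × ((m : ℕ) → ¬ A × ¬ B × k ≢ 1 × suc m ≡ k × m ∈ L → QNimC' L ≈ᴳ nim m)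
     × (¬ A × ¬ B × k ≢ 1 × ((m : ℕ) → suc m ≡ k → m ∉ L) → QNimC' L ≈ᴳ nim k)
mainTheorem8 L _ =
    (λ exc → ≈nim (let (top , 1∈L) = exceptional⇒ exc in value-with L top 1∈L))
  , (λ (_ , _ , k≡1) → ≈nim (value-at L k≡1))
  , (λ m (¬A , ¬B , k≢1 , m+1≡k , m∈L) →
       ≈nim (value-withBelow L m [ ¬A , ¬B ] k≢1 m+1≡k m∈L))
  , (λ (_ , _ , _ , noBelow) → ≈nim (value-withoutBelow L noBelow))
  where
  ≈nim : ∀ {v} → value L ≡ v → QNimC' L ≈ᴳ nim v
  ≈nim refl = QNimC'≈nim-value L
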